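{- Let $a,m,s\geq 1$ be integers and $t$ an integer. If $N_2(K(a;m))\leq t$, then $N_2(K(a;ms))\leq st+s-1$.
   Context: For a connected graph $G=(V,E)$, $N_2(G)$ is the minimum $N$ such that there is a map $g:V\to\{0,1,*\}^N$ with the property that for all $x,y\in V$, the graph distance between $x$ and $y$ equals the number of positions $j$ in which the $j$-th entries of $g(x)$ and $g(y)$ are distinct and neither equals $*$. For $a,m\geq 1$, $K(a;m)$ denotes the complete $m$-partite graph in which each of the $m$ parts has exactly $a$ vertices. -}

module Defs where

open import Data.Nat using (ℕ; zero; suc; _+_; _≤_)
open import Data.Integer as ℤ using (ℤ; +_)
open import Data.Fin using (Fin)
open import Data.Vec using (Vec; []; _∷_)
open import Data.Product using (Σ; ∃; _×_)
open import Relation.Binary.PropositionalEquality using (_≡_)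
open import Relation.Nullary using (¬_)

record Graph : Set₁ where
  field
    V     : Set
    Adj   : V → V → Set
    sym   : ∀ {x y} → Adj x y → Adj y x
    irref : ∀ {x} → ¬ Adj x x
open Graph public

data Walk (G : Graph) : V G → V G → ℕ → Set where
  here : ∀ {x} → Walk G x x 0
  step : ∀ {x y z k} → Adj G x y → Walk G y z k → Walk G x z (suc k)

Dist : (G : Graph) → V G → V G → ℕ → Set
Dist G x y d = Walk G x y d × (∀ k → Walk G x y k → d ≤ k)

data Tri : Set where
  t0 t1 star : Tri

clash : Tri → Tri → ℕ
clash t0 t1 = 1
clash t1 t0 = 1
clash _  _  = 0

δ : ∀ {N} → Vec Tri N → Vec Tri N → ℕ
δ []       []       = 0
δ (u ∷ us) (v ∷ vs) = clash u v + δ us vs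

IsEncoding : (G : Graph) (N : ℕ) → (V G → Vec Tri N) → Set
IsEncoding G N g = ∀ x y → Dist G x y (δ (g x) (g y))

-- N_2(G) ≤ t  (t an integer): some admissible N with N ≤ t exists
-- (N_2(G) is the minimum such N).
N₂≤ : Graph → ℤ → Set
N₂≤ G t = Σ ℕ λ N → (+ N ℤ.≤ t) × Σ (V G → Vec Tri N) (IsEncoding G N)

K : ℕ → ℕ → Graph
K a m = record
  { V     = Fin m × Fin a
  ; Adj   = λ u v → ¬ (Data.Product.proj₁ u ≡ Data.Product.proj₁ v)
  ; sym   = λ p q → p (Relation.Binary.PropositionalEquality.sym q)
  ; irref = λ p → p Relation.Binary.PropositionalEquality.refl
  }
  where import Data.Product
        import Relation.Binary.PropositionalEquality

-- K(a;ms) is s disjoint copies ("blocks") of K(a;m), with every two vertices in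
-- different blocks adjacent. Give each block its own slot of N coordinates, in which
-- its vertices carry their K(a;m) codes while all other blocks carry stars; then
-- distances inside a block are preserved and codes of different blocks are at
-- distance 0. Appending a code of the complete graph on the s blocks with s - 1
-- coordinates (block b gets 1…1 0 *…* with b ones) raises the distance between
-- different blocks to exactly 1, giving length sN + s - 1.
module Submission where

open import Defs hiding (sym)
open import Data.Nat using (ℕ; _≤_; _*_; zero; suc; _+_; z≤n; s≤s)
open import Data.Integer as ℤ using (ℤ; +_)
import Data.Nat.Properties as ℕP
import Data.Integer.Properties as ℤP
open import Data.Fin as Fin using (Fin; remQuot; combine)
import Data.Fin.Properties as FinP
open import Data.Vec using (Vec; []; _∷_; _++_; replicate)
open import Data.Product using (_,_; proj₁; proj₂)
open import Function.Definitions using (Injective)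
open import Relation.Binary.PropositionalEquality
open import Relation.Nullary using (¬_; yes; no)
open import Data.Empty using (⊥-elim)

stars : (n : ℕ) → Vec Tri n
stars n = replicate n star

δ-++ : ∀ {n k} (u : Vec Tri n) (u' : Vec Tri k) v v' →
       δ (u ++ u') (v ++ v') ≡ δ u v + δ u' v'
δ-++ []      u' []      v' = refl
δ-++ (x ∷ u) u' (y ∷ v) v' =
  trans (cong (λ n → clash x y + n) (δ-++ u u' v v')) (sym (ℕP.+-assoc (clash x y) _ _))

δ-starsˡ : ∀ n (v : Vec Tri n) → δ (stars n) v ≡ 0
δ-starsˡ zero    []      = refl
δ-starsˡ (suc n) (x ∷ v) = δ-starsˡ n v

δ-starsʳ : ∀ n (v : Vec Tri n) → δ v (stars n) ≡ 0
δ-starsʳ zero    []         = refl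
δ-starsʳ (suc n) (t0 ∷ v)   = δ-starsʳ n v
δ-starsʳ (suc n) (t1 ∷ v)   = δ-starsʳ n v
δ-starsʳ (suc n) (star ∷ v) = δ-starsʳ n v

inSlot : ∀ {N} (s : ℕ) → Fin s → Vec Tri N → Vec Tri (s * N)
inSlot {N} (suc s) Fin.zero    v = v ++ stars (s * N)
inSlot {N} (suc s) (Fin.suc b) v = stars N ++ inSlot s b v

δ-inSlot-same : ∀ {N} s (b : Fin s) (v w : Vec Tri N) →
                δ (inSlot s b v) (inSlot s b w) ≡ δ v w
δ-inSlot-same {N} (suc s) Fin.zero v w = begin
  δ (v ++ stars (s * N)) (w ++ stars (s * N)) ≡⟨ δ-++ v _ w _ ⟩
  δ v w + δ (stars (s * N)) (stars (s * N))   ≡⟨ cong (λ n → δ v w + n) (δ-starsˡ (s * N) _) ⟩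
  δ v w + 0                                   ≡⟨ ℕP.+-identityʳ _ ⟩
  δ v w                                       ∎
  where open ≡-Reasoning
δ-inSlot-same {N} (suc s) (Fin.suc b) v w =
  trans (δ-++ (stars N) _ (stars N) _)
        (cong₂ _+_ (δ-starsˡ N _) (δ-inSlot-same s b v w))

δ-inSlot-distinct : ∀ {N} s (b b' : Fin s) (v w : Vec Tri N) → ¬ b ≡ b' →
                    δ (inSlot s b v) (inSlot s b' w) ≡ 0
δ-inSlot-distinct (suc s) Fin.zero Fin.zero v w b≢b' = ⊥-elim (b≢b' refl)
δ-inSlot-distinct {N} (suc s) Fin.zero (Fin.suc b') v w _ =
  trans (δ-++ v _ (stars N) _) (cong₂ _+_ (δ-starsʳ N v) (δ-starsˡ (s * N) _))
δ-inSlot-distinct {N} (suc s) (Fin.suc b) Fin.zero v w _ =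
  trans (δ-++ (stars N) _ w _) (cong₂ _+_ (δ-starsˡ N w) (δ-starsʳ (s * N) (inSlot s b v)))
δ-inSlot-distinct {N} (suc s) (Fin.suc b) (Fin.suc b') v w b≢b' =
  trans (δ-++ (stars N) _ (stars N) _)
        (cong₂ _+_ (δ-starsˡ N _) (δ-inSlot-distinct s b b' v w (λ e → b≢b' (cong Fin.suc e))))

separator : (n : ℕ) → Fin (suc n) → Vec Tri n
separator zero    Fin.zero    = []
separator (suc n) Fin.zero    = t0 ∷ stars n
separator (suc n) (Fin.suc b) = t1 ∷ separator n b

δ-separator-same : ∀ n (b : Fin (suc n)) → δ (separator n b) (separator n b) ≡ 0
δ-separator-same zero    Fin.zero    = refl
δ-separator-same (suc n) Fin.zero    = δ-starsˡ n _
δ-separator-same (suc n) (Fin.suc b) = δ-separator-same n b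

δ-separator-distinct : ∀ n (b b' : Fin (suc n)) → ¬ b ≡ b' →
                       δ (separator n b) (separator n b') ≡ 1
δ-separator-distinct zero    Fin.zero     Fin.zero      b≢b' = ⊥-elim (b≢b' refl)
δ-separator-distinct (suc n) Fin.zero     Fin.zero      b≢b' = ⊥-elim (b≢b' refl)
δ-separator-distinct (suc n) Fin.zero     (Fin.suc b')  _    = cong suc (δ-starsˡ n _)
δ-separator-distinct (suc n) (Fin.suc b)  Fin.zero      _    = cong suc (δ-starsʳ n (separator n b))
δ-separator-distinct (suc n) (Fin.suc b)  (Fin.suc b')  b≢b' =
  δ-separator-distinct n b b' (λ e → b≢b' (cong Fin.suc e))

blockCode : ∀ {N} s' → Fin (suc s') → Vec Tri N → Vec Tri (suc s' * N + s')
blockCode s' b v = inSlot (suc s') b v ++ separator s' b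

δ-blockCode-same : ∀ {N} s' (b : Fin (suc s')) (v w : Vec Tri N) →
                   δ (blockCode s' b v) (blockCode s' b w) ≡ δ v w
δ-blockCode-same s' b v w = begin
  δ (blockCode s' b v) (blockCode s' b w)
    ≡⟨ δ-++ (inSlot (suc s') b v) _ (inSlot (suc s') b w) _ ⟩
  δ (inSlot (suc s') b v) (inSlot (suc s') b w) + δ (separator s' b) (separator s' b)
    ≡⟨ cong₂ _+_ (δ-inSlot-same (suc s') b v w) (δ-separator-same s' b) ⟩
  δ v w + 0
    ≡⟨ ℕP.+-identityʳ _ ⟩
  δ v w ∎
  where open ≡-Reasoning

δ-blockCode-distinct : ∀ {N} s' (b b' : Fin (suc s')) (v w : Vec Tri N) → ¬ b ≡ b' →
                       δ (blockCode s' b v) (blockCode s' b' w) ≡ 1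
δ-blockCode-distinct s' b b' v w b≢b' =
  trans (δ-++ (inSlot (suc s') b v) _ (inSlot (suc s') b' w) _)
        (cong₂ _+_ (δ-inSlot-distinct (suc s') b b' v w b≢b')
                   (δ-separator-distinct s' b b' b≢b'))

Walk-zero⇒≡ : ∀ {G x y} → Walk G x y 0 → x ≡ y
Walk-zero⇒≡ here = refl

Walk-one⇒Adj : ∀ {G x y} → Walk G x y 1 → Adj G x y
Walk-one⇒Adj (step p here) = p

Walk-map : ∀ {G H} (h : V G → V H) → (∀ {x y} → Adj G x y → Adj H (h x) (h y)) →
           ∀ {x y k} → Walk G x y k → Walk H (h x) (h y) k
Walk-map h hom here       = here
Walk-map h hom (step p w) = step (hom p) (Walk-map h hom w)

Adj⇒Dist-one : ∀ {G x y} → Adj G x y → Dist G x y 1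
Adj⇒Dist-one {G} {x} p = step p here , shortest
  where
    shortest : ∀ k → Walk G x _ k → 1 ≤ k
    shortest zero    w with refl ← Walk-zero⇒≡ w = ⊥-elim (irref G p)
    shortest (suc k) _ = s≤s z≤n

K-Dist≤2 : ∀ {a m} {x y : V (K a m)} {d} → Dist (K a m) x y d → d ≤ 2
K-Dist≤2 {d = zero}             _ = z≤n
K-Dist≤2 {d = suc zero}         _ = s≤s z≤n
K-Dist≤2 {d = suc (suc zero)}   _ = s≤s (s≤s z≤n)
-- Look at the first step x → z of a longer walk: either z lies in the part of y, so
-- x and y are adjacent, or x → z → y is a walk.
K-Dist≤2 {y = y} {d = suc (suc (suc d))} (step {y = z} x~z _ , shortest)
  with proj₁ z Fin.≟ proj₁ y
... | yes z≈y = ℕP.≤-trans (shortest 1 (step (λ x≈y → x~z (trans x≈y (sym z≈y))) here)) (s≤s z≤n)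
... | no z~y  = shortest 2 (step {y = z} x~z (step {y = y} z~y here))

mapParts : ∀ {a m n} → (Fin m → Fin n) → V (K a m) → V (K a n)
mapParts f (q , j) = f q , j

Dist-mapParts : ∀ {a m n} (f : Fin m → Fin n) → Injective _≡_ _≡_ f →
                ∀ {x y d} → Dist (K a m) x y d → Dist (K a n) (mapParts f x) (mapParts f y) d
Dist-mapParts {a} {n = n} f f-inj {q , j} {q' , j'} {d} D@(w , shortest) =
  Walk-map (mapParts f) (λ q≉q' e → q≉q' (f-inj e)) w , shortest'
  where
    shortest' : ∀ k → Walk (K a n) (f q , j) (f q' , j') k → d ≤ k
    shortest' zero w₀ with e ← Walk-zero⇒≡ w₀
      with refl ← f-inj (cong proj₁ e) | refl ← cong proj₂ e = shortest 0 here
    shortest' (suc zero) w₁ = shortest 1 (step (λ e → Walk-one⇒Adj w₁ (cong f e)) here)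
    shortest' (suc (suc k)) _ = ℕP.≤-trans (K-Dist≤2 D) (s≤s (s≤s z≤n))

module BlowUp {a m N : ℕ} (s' : ℕ) (g : V (K a m) → Vec Tri N)
              (g-encodes : IsEncoding (K a m) N g) where

  code : V (K a (m * suc s')) → Vec Tri (suc s' * N + s')
  code (i , j) = blockCode s' (proj₂ (remQuot {m} (suc s') i))
                                (g (proj₁ (remQuot {m} (suc s') i) , j))

  encodes-combined : ∀ q b j q' b' j' →
    Dist (K a (m * suc s')) (combine q b , j) (combine q' b' , j')
         (δ (blockCode s' b (g (q , j))) (blockCode s' b' (g (q' , j'))))
  encodes-combined q b j q' b' j' with b Fin.≟ b'
  ... | yes refl = subst (Dist _ _ _) (sym (δ-blockCode-same s' b _ _))
                     (Dist-mapParts (λ q → combine q b)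
                                    (λ {q} {q'} → FinP.combine-injectiveˡ q b q' b)
                                    (g-encodes (q , j) (q' , j')))
  ... | no b≢b'  = subst (Dist _ _ _) (sym (δ-blockCode-distinct s' b b' _ _ b≢b'))
                     (Adj⇒Dist-one (λ e → b≢b' (FinP.combine-injectiveʳ q b q' b' e)))

  code-encodes : IsEncoding (K a (m * suc s')) (suc s' * N + s') code
  code-encodes (i , j) (i' , j') =
    subst₂ (λ u u' → Dist _ (u , j) (u' , j') (δ (code (i , j)) (code (i' , j'))))
           (FinP.combine-remQuot {m} (suc s') i) (FinP.combine-remQuot {m} (suc s') i')
           (encodes-combined _ _ j _ _ j')

blowUp-length≤ : ∀ s' N t' → N ≤ t' →
                 + (suc s' * N + s') ℤ.≤ (+ suc s') ℤ.* (+ t') ℤ.+ (+ suc s') ℤ.- (+ 1)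
blowUp-length≤ s' N t' N≤t' =
  subst (+ (suc s' * N + s') ℤ.≤_) (sym bound≡)
        (ℤ.+≤+ (ℕP.+-monoˡ-≤ s' (ℕP.*-monoʳ-≤ (suc s') N≤t')))
  where
    open ≡-Reasoning
    bound≡ : (+ suc s') ℤ.* (+ t') ℤ.+ (+ suc s') ℤ.- (+ 1) ≡ + (suc s' * t' + s')
    bound≡ = begin
      (+ suc s') ℤ.* (+ t') ℤ.+ (+ suc s') ℤ.- (+ 1)   ≡⟨ ℤP.+-assoc ((+ suc s') ℤ.* (+ t')) _ _ ⟩
      (+ suc s') ℤ.* (+ t') ℤ.+ (+ s')                ≡⟨ cong (ℤ._+ (+ s')) (sym (ℤP.pos-* (suc s') t')) ⟩
      + (suc s' * t') ℤ.+ (+ s')                      ≡⟨ sym (ℤP.pos-+ (suc s' * t') s') ⟩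
      + (suc s' * t' + s')                            ∎

mainTheorem15 : (a m s : ℕ) → 1 ≤ a → 1 ≤ m → 1 ≤ s → (t : ℤ) → N₂≤ (K a m) t → N₂≤ (K a (m * s)) ((+ s) ℤ.* t ℤ.+ (+ s) ℤ.- (+ 1))
mainTheorem15 a m (suc s') _ _ _ .(+ t') (N , ℤ.+≤+ {n = t'} N≤t , g , g-encodes) =
  suc s' * N + s' , blowUp-length≤ s' N t' N≤t , BlowUp.code s' g g-encodes , BlowUp.code-encodes s' g g-encodes
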